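{- For every PLTL formula $W$ and every proposition symbol $x$, $\models\tau_1[\Box(x\Rightarrow W)]\Rightarrow\Box(x\Rightarrow W)$.
   Context: PLTL formulae are built from proposition symbols, $\mathbf{true}$, $\mathbf{false}$, $\neg,\vee,\wedge,\Rightarrow$ and temporal operators $\bigcirc$ (next), $\Diamond$ (sometime), $\Box$ (always), $\mathcal{U}$ (until), $\mathcal{W}$ (unless). A model is an infinite sequence $\sigma=s_0,s_1,\dots$ of sets of proposition symbols; $(\sigma,i)\models p$ iff $p\in s_i$; Boolean connectives as usual; $\bigcirc A$ at $i$ iff $A$ at $i+1$; $\Diamond A$ at $i$ iff $A$ at some $k\ge i$; $\Box A$ at $i$ iff $A$ at all $j\ge i$; $A\,\mathcal{U}\,B$ at $i$ iff $B$ at some $k\ge i$ and $A$ at all $j$, $i\le j<k$; $A\,\mathcal{W}\,B$ iff $A\,\mathcal{U}\,B$ or $\Box A$. $\mathbf{start}$ holds exactly at index $0$. $\models A$ (valid) means $(\sigma,0)\models A$ for every model $\sigma$. A literal is a proposition symbol or its negation. A PLTL-clause is $\mathbf{start}\Rightarrow\bigvee_c l_c$, $\bigwedge_a k_a\Rightarrow\bigcirc\bigvee_d l_d$ or $\bigwedge_b k_b\Rightarrow\Diamond l$ with all $k,l$ literals. $\tau_1$, applied to $\Box(x\Rightarrow W)$ ($x$ a proposition symbol), is computed by applying the following rewrite rules repeatedly until the result is a conjunction of formulae $\Box A_i$, each $A_i$ a PLTL-clause; $\tau_1[\Box(x\Rightarrow W)]$ denotes that final result (write $\tau_1[x\Rightarrow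 A]$ for $\tau_1[\Box(x\Rightarrow A)]$; $y,z,v$ are proposition symbols new at each application; $l,m,l_i$ literals; $\neg\mathbf{true}$, $\neg\mathbf{false}$ rewritten to $\mathbf{false}$, $\mathbf{true}$). (1) $x\Rightarrow(A\wedge B)\mapsto\tau_1[x\Rightarrow A]\wedge\tau_1[x\Rightarrow B]$; $x\Rightarrow(A\Rightarrow B)\mapsto\tau_1[x\Rightarrow\neg A\vee B]$; $x\Rightarrow\neg(A\wedge B)\mapsto\tau_1[x\Rightarrow\neg A\vee\neg B]$; $x\Rightarrow\neg(A\Rightarrow B)\mapsto\tau_1[x\Rightarrow A]\wedge\tau_1[x\Rightarrow\neg B]$; $x\Rightarrow\neg(A\vee B)\mapsto\tau_1[x\Rightarrow\neg A]\wedge\tau_1[x\Rightarrow\neg B]$. (2) $x\Rightarrow\bigcirc A\mapsto\Box(x\Rightarrow\bigcirc y)\wedge\tau_1[y\Rightarrow A]$ if $A$ is neither a literal nor a disjunction of literals; $x\Rightarrow\neg\bigcirc A\mapsto\Box(x\Rightarrow\bigcirc y)\wedge\tau_1[y\Rightarrow\neg A]$; $x\Rightarrow\Box A\mapsto\tau_1[x\Rightarrow\Box y]\wedge\tau_1[y\Rightarrow A]$ ($A$ not a literal); $x\Rightarrow\neg\Box A\mapsto\Box(x\Rightarrow\Diamond y)\wedge\tau_1[y\Rightarrow\neg A]$; $x\Rightarrow\Diamond A\mapsto\Box(x\Rightarrow\Diamond y)\wedge\tau_1[y\Rightarrow A]$ ($A$ not a literal); $x\Rightarrow\neg\Diamond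 A\mapsto\tau_1[x\Rightarrow\Box y]\wedge\tau_1[y\Rightarrow\neg A]$; $x\Rightarrow A\,\mathcal{U}\,B\mapsto\tau_1[x\Rightarrow y\,\mathcal{U}\,B]\wedge\tau_1[y\Rightarrow A]$ ($A$ not a literal), $\mapsto\tau_1[x\Rightarrow A\,\mathcal{U}\,y]\wedge\tau_1[y\Rightarrow B]$ ($B$ not a literal); the same with $\mathcal{W}$ for $\mathcal{U}$; $x\Rightarrow\neg(A\,\mathcal{U}\,B)\mapsto\tau_1[x\Rightarrow y\,\mathcal{W}\,v]\wedge\tau_1[y\Rightarrow\neg B]\wedge\tau_1[v\Rightarrow(y\wedge z)]\wedge\tau_1[z\Rightarrow\neg A]$; $x\Rightarrow\neg(A\,\mathcal{W}\,B)\mapsto\tau_1[x\Rightarrow y\,\mathcal{U}\,v]\wedge\tau_1[y\Rightarrow\neg B]\wedge\tau_1[v\Rightarrow(y\wedge z)]\wedge\tau_1[z\Rightarrow\neg A]$. (3) $x\Rightarrow\Box l\mapsto\tau_1[x\Rightarrow l]\wedge\tau_1[x\Rightarrow y]\wedge\Box(y\Rightarrow\bigcirc l)\wedge\Box(y\Rightarrow\bigcirc y)$; $x\Rightarrow l\,\mathcal{U}\,m\mapsto\Box(x\Rightarrow\Diamond m)\wedge\tau_1[x\Rightarrow l\vee m]\wedge\tau_1[x\Rightarrow y\vee m]\wedge\Box(y\Rightarrow\bigcirc(l\vee m))\wedge\Box(y\Rightarrow\bigcirc(y\vee m))$; $x\Rightarrow l\,\mathcal{W}\,m\mapsto$ the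 same without $\Box(x\Rightarrow\Diamond m)$. (4) $x\Rightarrow D\vee A\mapsto\tau_1[x\Rightarrow D\vee y]\wedge\tau_1[y\Rightarrow A]$, $D$ a disjunction, $A$ neither a literal nor a disjunction of literals. (5) $x\Rightarrow D\mapsto\Box(\mathbf{start}\Rightarrow\neg x\vee D)\wedge\Box(\mathbf{true}\Rightarrow\bigcirc(\neg x\vee D))$ for $D$ a literal or disjunction of literals; $x\Rightarrow\mathbf{true}\mapsto\Box(\mathbf{start}\Rightarrow\mathbf{true})\wedge\Box(\mathbf{true}\Rightarrow\bigcirc\mathbf{true})$; $x\Rightarrow\mathbf{false}\mapsto\Box(\mathbf{start}\Rightarrow\neg x)\wedge\Box(\mathbf{true}\Rightarrow\bigcirc\neg x)$; $\tau_1[x\Rightarrow\Diamond l]=\Box(x\Rightarrow\Diamond l)$; $\tau_1[x\Rightarrow\bigcirc(l_1\vee\dots\vee l_n)]=\Box(x\Rightarrow\bigcirc(l_1\vee\dots\vee l_n))$. -}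

module Defs where

open import Data.Nat using (ℕ; zero; suc; _≤_; _<_; _⊔_)
open import Data.Bool using (Bool; true; false; _∧_; if_then_else_)
open import Data.Product using (Σ; _×_; _,_; proj₁; ∃)
open import Data.Sum using (_⊎_)
open import Data.Empty using (⊥)
open import Data.Unit using (⊤)
open import Data.List using (List; []; _∷_; _++_)
open import Relation.Nullary using (¬_)
open import Relation.Binary.PropositionalEquality using (_≡_)

-- Proposition symbols are natural numbers.
-- `startᶠ` is included so that the output of τ₁ (PLTL-clauses) can be
-- expressed; the input formulae W of the lemma are required to be
-- start-free (they are "PLTL formulae" in the sense of the paper).

infixr 20 ¬ᶠ_ ○_ ◇_ □_
infixr 18 _∧ᶠ_
infixr 17 _∨ᶠ_
infixr 16 _⇒ᶠ_
infixr 19 _𝒰_ _𝒲_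

data Fm : Set where
  atom   : ℕ → Fm
  ⊤ᶠ     : Fm
  ⊥ᶠ     : Fm
  startᶠ : Fm
  ¬ᶠ_    : Fm → Fm
  _∨ᶠ_   : Fm → Fm → Fm
  _∧ᶠ_   : Fm → Fm → Fm
  _⇒ᶠ_   : Fm → Fm → Fm
  ○_     : Fm → Fm
  ◇_     : Fm → Fm
  □_     : Fm → Fm
  _𝒰_    : Fm → Fm → Fm
  _𝒲_    : Fm → Fm → Fm

StartFree : Fm → Set
StartFree (atom _) = ⊤
StartFree ⊤ᶠ = ⊤
StartFree ⊥ᶠ = ⊤
StartFree startᶠ = ⊥
StartFree (¬ᶠ A) = StartFree A
StartFree (A ∨ᶠ B) = StartFree A × StartFree B
StartFree (A ∧ᶠ B) = StartFree A × StartFree B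
StartFree (A ⇒ᶠ B) = StartFree A × StartFree B
StartFree (○ A) = StartFree A
StartFree (◇ A) = StartFree A
StartFree (□ A) = StartFree A
StartFree (A 𝒰 B) = StartFree A × StartFree B
StartFree (A 𝒲 B) = StartFree A × StartFree B

-- Semantics.  A model σ = s₀, s₁, … is given by its characteristic
-- function: p ∈ sᵢ  iff  σ i p ≡ true.

Model : Set
Model = ℕ → ℕ → Bool

Until : (ℕ → Set) → (ℕ → Set) → ℕ → Set
Until P Q i = Σ ℕ λ k → i ≤ k × Q k × (∀ j → i ≤ j → j < k → P j)

Always : (ℕ → Set) → ℕ → Set
Always P i = ∀ j → i ≤ j → P j

_,_⊨_ : Model → ℕ → Fm → Set
σ , i ⊨ atom p = σ i p ≡ true
σ , i ⊨ ⊤ᶠ = ⊤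
σ , i ⊨ ⊥ᶠ = ⊥
σ , i ⊨ startᶠ = i ≡ 0
σ , i ⊨ (¬ᶠ A) = ¬ (σ , i ⊨ A)
σ , i ⊨ (A ∨ᶠ B) = (σ , i ⊨ A) ⊎ (σ , i ⊨ B)
σ , i ⊨ (A ∧ᶠ B) = (σ , i ⊨ A) × (σ , i ⊨ B)
σ , i ⊨ (A ⇒ᶠ B) = (σ , i ⊨ A) → (σ , i ⊨ B)
σ , i ⊨ (○ A) = σ , suc i ⊨ A
σ , i ⊨ (◇ A) = Σ ℕ λ k → i ≤ k × (σ , k ⊨ A)
σ , i ⊨ (□ A) = Always (λ j → σ , j ⊨ A) i
σ , i ⊨ (A 𝒰 B) = Until (λ j → σ , j ⊨ A) (λ j → σ , j ⊨ B) i
σ , i ⊨ (A 𝒲 B) = Until (λ j → σ , j ⊨ A) (λ j → σ , j ⊨ B) i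
                  ⊎ Always (λ j → σ , j ⊨ A) i

Valid : Fm → Set
Valid A = ∀ (σ : Model) → σ , 0 ⊨ A

isLit : Fm → Bool
isLit (atom _) = true
isLit (¬ᶠ atom _) = true
isLit _ = false

isDisjLits : Fm → Bool
isDisjLits (A ∨ᶠ B) = isDisjLits A ∧ isDisjLits B
isDisjLits A = isLit A

maxVar : Fm → ℕ
maxVar (atom p) = p
maxVar ⊤ᶠ = 0
maxVar ⊥ᶠ = 0
maxVar startᶠ = 0
maxVar (¬ᶠ A) = maxVar A
maxVar (A ∨ᶠ B) = maxVar A ⊔ maxVar B
maxVar (A ∧ᶠ B) = maxVar A ⊔ maxVar B
maxVar (A ⇒ᶠ B) = maxVar A ⊔ maxVar B
maxVar (○ A) = maxVar A
maxVar (◇ A) = maxVar A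
maxVar (□ A) = maxVar A
maxVar (A 𝒰 B) = maxVar A ⊔ maxVar B
maxVar (A 𝒲 B) = maxVar A ⊔ maxVar B

Gen : Set → Set
Gen A = ℕ → A × ℕ

return : {A : Set} → A → Gen A
return a n = a , n

_>>=_ : {A B : Set} → Gen A → (A → Gen B) → Gen B
(m >>= f) n with m n
... | a , n′ = f a n′

fresh : Gen ℕ
fresh n = n , suc n

conjAll : Fm → List Fm → Fm
conjAll c [] = c
conjAll c (d ∷ ds) = c ∧ᶠ conjAll d ds

-- Rule (5): x ⇒ D, D a literal or a disjunction of literals.
rule5 : ℕ → Fm → Fm
rule5 x D = □ (startᶠ ⇒ᶠ (¬ᶠ atom x ∨ᶠ D)) ∧ᶠ □ (⊤ᶠ ⇒ᶠ ○ (¬ᶠ atom x ∨ᶠ D))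

rule5-true : ℕ → Fm
rule5-true x = □ (startᶠ ⇒ᶠ ⊤ᶠ) ∧ᶠ □ (⊤ᶠ ⇒ᶠ ○ ⊤ᶠ)

rule5-false : ℕ → Fm
rule5-false x = □ (startᶠ ⇒ᶠ ¬ᶠ atom x) ∧ᶠ □ (⊤ᶠ ⇒ᶠ ○ (¬ᶠ atom x))

boxLit : ℕ → Fm → Gen Fm
boxLit x l = fresh >>= λ y →
  return (rule5 x l ∧ᶠ rule5 x (atom y)
          ∧ᶠ □ (atom y ⇒ᶠ ○ l) ∧ᶠ □ (atom y ⇒ᶠ ○ atom y))

unlessLits : ℕ → Fm → Fm → Gen Fm
unlessLits x l m = fresh >>= λ y →
  return (rule5 x (l ∨ᶠ m) ∧ᶠ rule5 x (atom y ∨ᶠ m)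
          ∧ᶠ □ (atom y ⇒ᶠ ○ (l ∨ᶠ m)) ∧ᶠ □ (atom y ⇒ᶠ ○ (atom y ∨ᶠ m)))

untilLits : ℕ → Fm → Fm → Gen Fm
untilLits x l m = unlessLits x l m >>= λ w →
  return (□ (atom x ⇒ᶠ ◇ m) ∧ᶠ w)

-- τ₁.  pos x A computes τ₁[x ⇒ A]; neg x A computes τ₁[x ⇒ ¬A].
-- dpos / dneg process a disjunct A / ¬A of a disjunction (rule (4)):
-- literal disjuncts are kept, every other disjunct is replaced by a new
-- symbol y and τ₁[y ⇒ disjunct] is added.  litOr does the same for the
-- arguments of 𝒰 / 𝒲 (rule (2)).

mutual
  pos : ℕ → Fm → Gen Fm
  pos x (atom p) = return (rule5 x (atom p))
  pos x ⊤ᶠ = return (rule5-true x)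
  pos x ⊥ᶠ = return (rule5-false x)
  pos x startᶠ = return (□ (atom x ⇒ᶠ startᶠ))   -- not a PLTL formula; never used
  pos x (¬ᶠ A) = neg x A
  pos x (A ∨ᶠ B) = dpos A >>= λ { (a , ca) → dpos B >>= λ { (b , cb) →
                   return (conjAll (rule5 x (a ∨ᶠ b)) (ca ++ cb)) } }
  pos x (A ∧ᶠ B) = pos x A >>= λ a → pos x B >>= λ b → return (a ∧ᶠ b)
  pos x (A ⇒ᶠ B) = dneg A >>= λ { (a , ca) → dpos B >>= λ { (b , cb) →
                   return (conjAll (rule5 x (a ∨ᶠ b)) (ca ++ cb)) } }
  pos x (○ A) = if isDisjLits A
                then return (□ (atom x ⇒ᶠ ○ A))
                else (fresh >>= λ y → pos y A >>= λ c →
                      return (□ (atom x ⇒ᶠ ○ atom y) ∧ᶠ c))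
  pos x (◇ A) = if isLit A
                then return (□ (atom x ⇒ᶠ ◇ A))
                else (fresh >>= λ y → pos y A >>= λ c →
                      return (□ (atom x ⇒ᶠ ◇ atom y) ∧ᶠ c))
  pos x (□ A) = if isLit A
                then boxLit x A
                else (fresh >>= λ y → boxLit x (atom y) >>= λ b →
                      pos y A >>= λ c → return (b ∧ᶠ c))
  pos x (A 𝒰 B) = litOr A >>= λ { (a , ca) → litOr B >>= λ { (b , cb) →
                  untilLits x a b >>= λ u → return (conjAll u (cb ++ ca)) } }
  pos x (A 𝒲 B) = litOr A >>= λ { (a , ca) → litOr B >>= λ { (b , cb) →
                  unlessLits x a b >>= λ u → return (conjAll u (cb ++ ca)) } }

  neg : ℕ → Fm → Gen Fm
  neg x (atom p) = return (rule5 x (¬ᶠ atom p))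
  neg x ⊤ᶠ = return (rule5-false x)
  neg x ⊥ᶠ = return (rule5-true x)
  neg x startᶠ = return (□ (atom x ⇒ᶠ ¬ᶠ startᶠ))   -- never used
  neg x (¬ᶠ A) = pos x A
  neg x (A ∧ᶠ B) = dneg A >>= λ { (a , ca) → dneg B >>= λ { (b , cb) →
                   return (conjAll (rule5 x (a ∨ᶠ b)) (ca ++ cb)) } }
  neg x (A ⇒ᶠ B) = pos x A >>= λ a → neg x B >>= λ b → return (a ∧ᶠ b)
  neg x (A ∨ᶠ B) = neg x A >>= λ a → neg x B >>= λ b → return (a ∧ᶠ b)
  neg x (○ A) = fresh >>= λ y → neg y A >>= λ c →
                return (□ (atom x ⇒ᶠ ○ atom y) ∧ᶠ c)
  neg x (□ A) = fresh >>= λ y → neg y A >>= λ c →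
                return (□ (atom x ⇒ᶠ ◇ atom y) ∧ᶠ c)
  neg x (◇ A) = fresh >>= λ y → boxLit x (atom y) >>= λ b →
                neg y A >>= λ c → return (b ∧ᶠ c)
  neg x (A 𝒰 B) = fresh >>= λ y → fresh >>= λ v → fresh >>= λ z →
                  unlessLits x (atom y) (atom v) >>= λ w →
                  neg y B >>= λ cB → neg z A >>= λ cA →
                  return (w ∧ᶠ cB ∧ᶠ (rule5 v (atom y) ∧ᶠ rule5 v (atom z)) ∧ᶠ cA)
  neg x (A 𝒲 B) = fresh >>= λ y → fresh >>= λ v → fresh >>= λ z →
                  untilLits x (atom y) (atom v) >>= λ w →
                  neg y B >>= λ cB → neg z A >>= λ cA →
                  return (w ∧ᶠ cB ∧ᶠ (rule5 v (atom y) ∧ᶠ rule5 v (atom z)) ∧ᶠ cA)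

  dpos : Fm → Gen (Fm × List Fm)
  dpos (A ∨ᶠ B) = dpos A >>= λ { (a , ca) → dpos B >>= λ { (b , cb) →
                  return (a ∨ᶠ b , ca ++ cb) } }
  dpos (atom p) = return (atom p , [])
  dpos (¬ᶠ atom p) = return (¬ᶠ atom p , [])
  dpos A = fresh >>= λ y → pos y A >>= λ c → return (atom y , c ∷ [])

  dneg : Fm → Gen (Fm × List Fm)
  dneg (atom p) = return (¬ᶠ atom p , [])
  dneg A = fresh >>= λ y → neg y A >>= λ c → return (atom y , c ∷ [])

  litOr : Fm → Gen (Fm × List Fm)
  litOr A = if isLit A
            then return (A , [])
            else (fresh >>= λ y → pos y A >>= λ c → return (atom y , c ∷ []))

-- τ₁[□(x ⇒ W)], new symbols drawn from those larger than x and all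
-- symbols of W.
τ₁ : ℕ → Fm → Fm
τ₁ x W = proj₁ (pos x W (suc (x ⊔ maxVar W)))

{-# OPTIONS --safe #-}
-- By induction on W: in any model of τ₁[x ⇒ W] every new symbol y that
-- τ₁ introduces for a subformula A satisfies □(y ⇒ A), so the clauses
-- built from the new symbols entail the corresponding formulae.  Only
-- this direction of the renaming is needed.  The one non-constructive
-- step is rule (3) for 𝒲: its clauses make (l ∨ m) ∧ (y ∨ m) an
-- invariant while m has not occurred, which yields l 𝒰 m if m ever
-- occurs and □ l otherwise; deciding which case holds needs excluded
-- middle.
module Submission where

open import Defs
open import Data.Nat using (ℕ; zero; suc; _+_; _≤_; _<_; z≤n; s≤s)
open import Data.Nat.Properties
  using (m≤n⇒m<n∨m≡n; <-cmp; m≤n⇒∃[o]m+o≡n; +-identityʳ; +-suc; ≤-refl; ≤-trans; n≤1+n; <⇒≱)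
open import Level using (0ℓ)
open import Axiom.ExcludedMiddle using (ExcludedMiddle)
open import Data.Product using (Σ; _×_; _,_; proj₁; proj₂)
open import Data.Sum using (_⊎_; inj₁; inj₂; [_,_]′)
import Data.Sum as Sum
open import Data.Unit using (tt)
open import Data.Bool using (true; false)
open import Data.List using (List; []; _∷_; _++_)
open import Data.List.Relation.Unary.All using (All; []; _∷_; head)
open import Data.List.Relation.Unary.All.Properties using (++⁻)
open import Function using (id; _∘_)
open import Relation.Nullary using (¬_; yes; no; contradiction)
open import Relation.Binary.PropositionalEquality using (refl; subst)
open import Relation.Binary.Definitions using (tri<; tri≈; tri>)

Eventually : (ℕ → Set) → ℕ → Set
Eventually P i = Σ ℕ λ k → i ≤ k × P k

Unless : (ℕ → Set) → (ℕ → Set) → ℕ → Set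
Unless P Q i = Until P Q i ⊎ Always P i

module _ {P : ℕ → Set} where

  always-from : ∀ {i} → P i → (∀ k → i ≤ k → P k → P (suc k)) → Always P i
  always-from p step k i≤k with m≤n⇒m<n∨m≡n i≤k
  ... | inj₂ refl = p
  always-from p step (suc k) _ | inj₁ (s≤s i≤k) = step k i≤k (always-from p step k i≤k)

module _ {P Q : ℕ → Set} where

  until-now : ∀ {i} → Q i → Until P Q i
  until-now q = _ , ≤-refl , q , λ j i≤j j<i → contradiction i≤j (<⇒≱ j<i)

  until-step : ∀ {i} → P i → Until P Q (suc i) → Until P Q i
  until-step {i} p (k , i<k , q , before) = k , ≤-trans (n≤1+n i) i<k , q , earlier
    where
    earlier : ∀ j → i ≤ j → j < k → P j
    earlier j i≤j j<k with m≤n⇒m<n∨m≡n i≤j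
    ... | inj₂ refl = p
    ... | inj₁ i<j  = before j i<j j<k

module _ {P Q P′ Q′ : ℕ → Set} (f : ∀ j → P j → P′ j) (g : ∀ j → Q j → Q′ j) where

  until-map : ∀ {i} → Until P Q i → Until P′ Q′ i
  until-map (k , i≤k , q , before) = k , i≤k , g k q , λ j i≤j j<k → f j (before j i≤j j<k)

  unless-map : ∀ {i} → Unless P Q i → Unless P′ Q′ i
  unless-map (inj₁ u)   = inj₁ (until-map u)
  unless-map (inj₂ all) = inj₂ λ j i≤j → f j (all j i≤j)

-- Rule (3) for l 𝒲 m with new symbol y: x implies (l ∨ m) ∧ (y ∨ m),
-- and y implies it at the next index.
UnlessInvariant : (P Q R : ℕ → Set) → ℕ → Set
UnlessInvariant P Q R j = (P j ⊎ Q j) × (R j ⊎ Q j)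

module _ {P Q R : ℕ → Set} (step : ∀ j → R j → UnlessInvariant P Q R (suc j)) where

  until-from-invariant : ∀ {i} → UnlessInvariant P Q R i → Eventually Q i → Until P Q i
  until-from-invariant inv (k , i≤k , q) with m≤n⇒∃[o]m+o≡n i≤k
  ... | d , refl = until-within d inv q
    where
    until-within : ∀ d {i} → UnlessInvariant P Q R i → Q (i + d) → Until P Q i
    until-within _       (inj₂ q , _)          _ = until-now q
    until-within _       (inj₁ _ , inj₂ q)     _ = until-now q
    until-within zero    {i} (inj₁ _ , inj₁ _) q = until-now (subst Q (+-identityʳ i) q)
    until-within (suc d) {i} (inj₁ p , inj₁ r) q =
      until-step p (until-within d (step i r) (subst Q (+-suc i d) q))

  always-from-invariant : ∀ {i} → UnlessInvariant P Q R i → ¬ Eventually Q i → Always P i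
  always-from-invariant {i} inv never k i≤k =
    [ id , (λ q → contradiction (k , i≤k , q) never) ]′ (proj₁ (always-from inv preserve k i≤k))
    where
    preserve : ∀ k → i ≤ k → UnlessInvariant P Q R k → UnlessInvariant P Q R (suc k)
    preserve k _   (_ , inj₁ r) = step k r
    preserve k i≤k (_ , inj₂ q) = contradiction (k , i≤k , q) never

  unless-from-invariant : ExcludedMiddle 0ℓ → ∀ {i} → UnlessInvariant P Q R i → Unless P Q i
  unless-from-invariant em {i} inv with em {Eventually Q i}
  ... | yes eventually = inj₁ (until-from-invariant inv eventually)
  ... | no never       = inj₂ (always-from-invariant inv never)

module _ {A B Y V : ℕ → Set}
         (Y⇒¬B : ∀ j → Y j → ¬ B j) (V⇒Y∧¬A : ∀ j → V j → Y j × ¬ A j) where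

  unless-refutes-until : ∀ {i} → Unless Y V i → ¬ Until A B i
  unless-refutes-until (inj₂ always-Y) (k , i≤k , b , _) = Y⇒¬B k (always-Y k i≤k) b
  unless-refutes-until (inj₁ (k′ , i≤k′ , v , before-Y)) (k , i≤k , b , before-A) with <-cmp k′ k
  ... | tri< k′<k _ _ = proj₂ (V⇒Y∧¬A k′ v) (before-A k′ i≤k′ k′<k)
  ... | tri≈ _ refl _ = Y⇒¬B k (proj₁ (V⇒Y∧¬A k v)) b
  ... | tri> _ _ k<k′ = Y⇒¬B k (before-Y k i≤k k<k′) b

  until-refutes-unless : ∀ {i} → Until Y V i → ¬ Unless A B i
  until-refutes-unless u (inj₁ u′) = unless-refutes-until (inj₁ u) u′
  until-refutes-unless (k , i≤k , v , _) (inj₂ always-A) = proj₂ (V⇒Y∧¬A k v) (always-A k i≤k)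

module Soundness (em : ExcludedMiddle 0ℓ) (σ : Model) where

  Holds : Fm → Set
  Holds F = σ , 0 ⊨ F

  -- A record rather than a function type, so that A and B can be inferred.
  infix 4 _⟹_
  record _⟹_ (A B : Fm) : Set where
    constructor ⟹-intro
    field ⟹-elim : ∀ i → σ , i ⊨ A → σ , i ⊨ B
  open _⟹_ public

  ⟹-refl : ∀ {A} → A ⟹ A
  ⟹-refl = ⟹-intro λ _ a → a

  ⟹-trans : ∀ {A B C} → A ⟹ B → B ⟹ C → A ⟹ C
  ⟹-trans f g = ⟹-intro λ i a → ⟹-elim g i (⟹-elim f i a)

  □⇒-elim : ∀ {A B} → Holds (□ (A ⇒ᶠ B)) → A ⟹ B
  □⇒-elim h = ⟹-intro λ i → h i z≤n

  ∨-mono : ∀ {a b A B} → a ⟹ A → b ⟹ B → a ∨ᶠ b ⟹ A ∨ᶠ B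
  ∨-mono f g = ⟹-intro λ i → Sum.map (⟹-elim f i) (⟹-elim g i)

  ◇-mono : ∀ {a A} → a ⟹ A → ◇ a ⟹ ◇ A
  ◇-mono f = ⟹-intro λ { i (k , i≤k , a) → k , i≤k , ⟹-elim f k a }

  □-mono : ∀ {a A} → a ⟹ A → □ a ⟹ □ A
  □-mono f = ⟹-intro λ i all k i≤k → ⟹-elim f k (all k i≤k)

  𝒰-mono : ∀ {a b A B} → a ⟹ A → b ⟹ B → a 𝒰 b ⟹ A 𝒰 B
  𝒰-mono f g = ⟹-intro λ i → until-map (⟹-elim f) (⟹-elim g)

  𝒲-mono : ∀ {a b A B} → a ⟹ A → b ⟹ B → a 𝒲 b ⟹ A 𝒲 B
  𝒲-mono f g = ⟹-intro λ i → unless-map (⟹-elim f) (⟹-elim g)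

  ¬∨-⟹-⇒ : ∀ {A B} → ¬ᶠ A ∨ᶠ B ⟹ A ⇒ᶠ B
  ¬∨-⟹-⇒ = ⟹-intro λ i → [ (λ ¬a a → contradiction a ¬a) , (λ b _ → b) ]′

  ¬∨¬-⟹-¬∧ : ∀ {A B} → ¬ᶠ A ∨ᶠ ¬ᶠ B ⟹ ¬ᶠ (A ∧ᶠ B)
  ¬∨¬-⟹-¬∧ = ⟹-intro λ i → [ (λ ¬a → ¬a ∘ proj₁) , (λ ¬b → ¬b ∘ proj₂) ]′

  ◇¬-⟹-¬□ : ∀ {A} → ◇ ¬ᶠ A ⟹ ¬ᶠ □ A
  ◇¬-⟹-¬□ = ⟹-intro λ { i (k , i≤k , ¬a) all → ¬a (all k i≤k) }

  □¬-⟹-¬◇ : ∀ {A} → □ ¬ᶠ A ⟹ ¬ᶠ ◇ A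
  □¬-⟹-¬◇ = ⟹-intro λ { i all (k , i≤k , a) → all k i≤k a }

  ∧-intro : ∀ {a A B} → a ⟹ A → a ⟹ B → a ⟹ A ∧ᶠ B
  ∧-intro f g = ⟹-intro λ i a → ⟹-elim f i a , ⟹-elim g i a

  ∧-elimˡ : ∀ {A B} → A ∧ᶠ B ⟹ A
  ∧-elimˡ = ⟹-intro λ _ → proj₁

  □-induction : ∀ {A} → A ⟹ ○ A → A ⟹ □ A
  □-induction step = ⟹-intro λ i a → always-from a (λ k _ → ⟹-elim step k)

  holds-everywhere : ∀ A → Holds (□ (startᶠ ⇒ᶠ A)) → Holds (□ (⊤ᶠ ⇒ᶠ ○ A)) →
                     ∀ i → σ , i ⊨ A
  holds-everywhere A initially _    zero    = initially 0 z≤n refl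
  holds-everywhere A _         next (suc i) = next i z≤n tt

  rule5-sound : ∀ x D → Holds (rule5 x D) → atom x ⟹ D
  rule5-sound x D (initially , next) =
    ⟹-intro λ i x-holds →
      [ contradiction x-holds , id ]′ (holds-everywhere (¬ᶠ atom x ∨ᶠ D) initially next i)

  rule5-false-sound : ∀ x → Holds (rule5-false x) → atom x ⟹ ⊥ᶠ
  rule5-false-sound x (initially , next) = ⟹-intro (holds-everywhere (¬ᶠ atom x) initially next)

  boxLit-sound : ∀ x l y → Holds (proj₁ (boxLit x l y)) → atom x ⟹ □ l
  boxLit-sound x l y (x⇒l , x⇒y , y⇒○l , y⇒○y) =
    ⟹-trans (∧-intro (rule5-sound x l x⇒l) (rule5-sound x (atom y) x⇒y))
            (⟹-trans (□-induction l∧y-inductive) (□-mono ∧-elimˡ))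
    where
    l∧y-inductive : l ∧ᶠ atom y ⟹ ○ (l ∧ᶠ atom y)
    l∧y-inductive = ⟹-intro λ { j (_ , y-holds) → y⇒○l j z≤n y-holds , y⇒○y j z≤n y-holds }

  unlessLits-invariant : ∀ x l m y → Holds (proj₁ (unlessLits x l m y)) →
    (atom x ⟹ (l ∨ᶠ m) ∧ᶠ (atom y ∨ᶠ m)) × (atom y ⟹ ○ ((l ∨ᶠ m) ∧ᶠ (atom y ∨ᶠ m)))
  unlessLits-invariant x l m y (x⇒l∨m , x⇒y∨m , y⇒○l∨m , y⇒○y∨m) =
    ∧-intro (rule5-sound x (l ∨ᶠ m) x⇒l∨m) (rule5-sound x (atom y ∨ᶠ m) x⇒y∨m) ,
    ⟹-intro (λ j y-holds → y⇒○l∨m j z≤n y-holds , y⇒○y∨m j z≤n y-holds)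

  unlessLits-sound : ∀ x l m y → Holds (proj₁ (unlessLits x l m y)) → atom x ⟹ l 𝒲 m
  unlessLits-sound x l m y h =
    let initially , step = unlessLits-invariant x l m y h
    in ⟹-intro λ i x-holds → unless-from-invariant (⟹-elim step) em (⟹-elim initially i x-holds)

  untilLits-sound : ∀ x l m y → Holds (proj₁ (untilLits x l m y)) → atom x ⟹ l 𝒰 m
  untilLits-sound x l m y (x⇒◇m , h) =
    let initially , step = unlessLits-invariant x l m y h
    in ⟹-intro λ i x-holds →
         until-from-invariant (⟹-elim step) (⟹-elim initially i x-holds) (x⇒◇m i z≤n x-holds)

  conjAll⁻ : ∀ c ds → Holds (conjAll c ds) → Holds c × All Holds ds
  conjAll⁻ c []       h        = h , []
  conjAll⁻ c (d ∷ ds) (hc , h) = let hd , hds = conjAll⁻ d ds h in hc , hd ∷ hds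

  conjAll-++⁻ : ∀ c cs ds → Holds (conjAll c (cs ++ ds)) → Holds c × All Holds cs × All Holds ds
  conjAll-++⁻ c cs ds h = let hc , hcsds = conjAll⁻ c (cs ++ ds) h in hc , ++⁻ cs hcsds

  -- A renaming (a , cs) of A: the literal or disjunction of literals a,
  -- whose new symbols are constrained by the side clauses cs.
  SoundRenaming : Fm → Fm × List Fm → Set
  SoundRenaming A (a , cs) = All Holds cs → a ⟹ A

  renamed-disjunction-sound : ∀ x {A B} (r s : Fm × List Fm) → SoundRenaming A r → SoundRenaming B s →
    Holds (conjAll (rule5 x (proj₁ r ∨ᶠ proj₁ s)) (proj₂ r ++ proj₂ s)) → atom x ⟹ A ∨ᶠ B
  renamed-disjunction-sound x (a , cs) (b , ds) a⇒A b⇒B h =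
    let x⇒a∨b , hcs , hds = conjAll-++⁻ (rule5 x (a ∨ᶠ b)) cs ds h
    in ⟹-trans (rule5-sound x (a ∨ᶠ b) x⇒a∨b) (∨-mono (a⇒A hcs) (b⇒B hds))

  ¬𝒰-intro : ∀ {x y v A B} → atom x ⟹ atom y 𝒲 atom v → atom y ⟹ ¬ᶠ B →
             atom v ⟹ atom y ∧ᶠ ¬ᶠ A → atom x ⟹ ¬ᶠ (A 𝒰 B)
  ¬𝒰-intro x⇒y𝒲v y⇒¬B v⇒y∧¬A = ⟹-intro λ i x-holds →
    unless-refutes-until (⟹-elim y⇒¬B) (⟹-elim v⇒y∧¬A) (⟹-elim x⇒y𝒲v i x-holds)

  ¬𝒲-intro : ∀ {x y v A B} → atom x ⟹ atom y 𝒰 atom v → atom y ⟹ ¬ᶠ B →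
             atom v ⟹ atom y ∧ᶠ ¬ᶠ A → atom x ⟹ ¬ᶠ (A 𝒲 B)
  ¬𝒲-intro x⇒y𝒰v y⇒¬B v⇒y∧¬A = ⟹-intro λ i x-holds →
    until-refutes-unless (⟹-elim y⇒¬B) (⟹-elim v⇒y∧¬A) (⟹-elim x⇒y𝒰v i x-holds)

  mutual
    pos-sound : ∀ x A n → StartFree A → Holds (proj₁ (pos x A n)) → atom x ⟹ A
    pos-sound x (atom p) n _ h = rule5-sound x (atom p) h
    pos-sound x ⊤ᶠ n _ _ = ⟹-intro λ _ _ → tt
    pos-sound x ⊥ᶠ n _ h = rule5-false-sound x h
    pos-sound x startᶠ n () _
    pos-sound x (¬ᶠ A) n sf h = neg-sound x A n sf h
    pos-sound x (A ∨ᶠ B) n (sfA , sfB) =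
      renamed-disjunction-sound x _ _ (dpos-sound A n sfA) (dpos-sound B _ sfB)
    pos-sound x (A ∧ᶠ B) n (sfA , sfB) (hA , hB) =
      ∧-intro (pos-sound x A n sfA hA) (pos-sound x B _ sfB hB)
    pos-sound x (A ⇒ᶠ B) n (sfA , sfB) h =
      ⟹-trans (renamed-disjunction-sound x _ _ (dneg-sound A n sfA) (dpos-sound B _ sfB) h) ¬∨-⟹-⇒
    pos-sound x (○ A) n sf h with isDisjLits A
    ... | true  = □⇒-elim h
    ... | false = let x⇒○y , hA = h in
      ⟹-intro λ i x-holds → ⟹-elim (pos-sound n A (suc n) sf hA) (suc i) (x⇒○y i z≤n x-holds)
    pos-sound x (◇ A) n sf h with isLit A
    ... | true  = □⇒-elim h
    ... | false = let x⇒◇y , hA = h in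
      ⟹-trans (□⇒-elim x⇒◇y) (◇-mono (pos-sound n A (suc n) sf hA))
    pos-sound x (□ A) n sf h with isLit A
    ... | true  = boxLit-sound x A n h
    ... | false = let x⇒□y , hA = h in
      ⟹-trans (boxLit-sound x (atom n) (suc n) x⇒□y) (□-mono (pos-sound n A _ sf hA))
    pos-sound x (A 𝒰 B) n (sfA , sfB) h =
      let a , ca = proj₁ (litOr A n)
          b , cb = proj₁ (litOr B (proj₂ (litOr A n)))
          hu , hB , hA = conjAll-++⁻ _ cb ca h
      in ⟹-trans (untilLits-sound x a b _ hu) (𝒰-mono (litOr-sound A n sfA hA) (litOr-sound B _ sfB hB))
    pos-sound x (A 𝒲 B) n (sfA , sfB) h =
      let a , ca = proj₁ (litOr A n)
          b , cb = proj₁ (litOr B (proj₂ (litOr A n)))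
          hw , hB , hA = conjAll-++⁻ _ cb ca h
      in ⟹-trans (unlessLits-sound x a b _ hw) (𝒲-mono (litOr-sound A n sfA hA) (litOr-sound B _ sfB hB))

    neg-sound : ∀ x A n → StartFree A → Holds (proj₁ (neg x A n)) → atom x ⟹ ¬ᶠ A
    neg-sound x (atom p) n _ h = rule5-sound x (¬ᶠ atom p) h
    neg-sound x ⊤ᶠ n _ h = ⟹-intro λ i x-holds _ → ⟹-elim (rule5-false-sound x h) i x-holds
    neg-sound x ⊥ᶠ n _ _ = ⟹-intro λ _ _ → id
    neg-sound x startᶠ n () _
    neg-sound x (¬ᶠ A) n sf h = ⟹-intro λ i x-holds ¬a → ¬a (⟹-elim (pos-sound x A n sf h) i x-holds)
    neg-sound x (A ∧ᶠ B) n (sfA , sfB) h =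
      ⟹-trans (renamed-disjunction-sound x _ _ (dneg-sound A n sfA) (dneg-sound B _ sfB) h) ¬∨¬-⟹-¬∧
    neg-sound x (A ⇒ᶠ B) n (sfA , sfB) (hA , hB) = ⟹-intro λ i x-holds a⇒b →
      ⟹-elim (neg-sound x B _ sfB hB) i x-holds (a⇒b (⟹-elim (pos-sound x A n sfA hA) i x-holds))
    neg-sound x (A ∨ᶠ B) n (sfA , sfB) (hA , hB) = ⟹-intro λ i x-holds →
      [ ⟹-elim (neg-sound x A n sfA hA) i x-holds , ⟹-elim (neg-sound x B _ sfB hB) i x-holds ]′
    neg-sound x (○ A) n sf (x⇒○y , hA) =
      ⟹-intro λ i x-holds → ⟹-elim (neg-sound n A (suc n) sf hA) (suc i) (x⇒○y i z≤n x-holds)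
    neg-sound x (□ A) n sf (x⇒◇y , hA) =
      ⟹-trans (□⇒-elim x⇒◇y) (⟹-trans (◇-mono (neg-sound n A (suc n) sf hA)) ◇¬-⟹-¬□)
    neg-sound x (◇ A) n sf (x⇒□y , hA) =
      ⟹-trans (boxLit-sound x (atom n) (suc n) x⇒□y)
              (⟹-trans (□-mono (neg-sound n A _ sf hA)) □¬-⟹-¬◇)
    neg-sound x (A 𝒰 B) n (sfA , sfB) (hw , hB , (v⇒y , v⇒z) , hA) =
      ¬𝒰-intro (unlessLits-sound x _ _ _ hw) (neg-sound n B _ sfB hB)
               (∧-intro (rule5-sound _ _ v⇒y) (⟹-trans (rule5-sound _ _ v⇒z) (neg-sound _ A _ sfA hA)))
    neg-sound x (A 𝒲 B) n (sfA , sfB) (hu , hB , (v⇒y , v⇒z) , hA) =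
      ¬𝒲-intro (untilLits-sound x _ _ _ hu) (neg-sound n B _ sfB hB)
               (∧-intro (rule5-sound _ _ v⇒y) (⟹-trans (rule5-sound _ _ v⇒z) (neg-sound _ A _ sfA hA)))

    dpos-sound : ∀ A n → StartFree A → SoundRenaming A (proj₁ (dpos A n))
    dpos-sound (A ∨ᶠ B) n (sfA , sfB) h =
      let hA , hB = ++⁻ (proj₂ (proj₁ (dpos A n))) h
      in ∨-mono (dpos-sound A n sfA hA) (dpos-sound B _ sfB hB)
    dpos-sound (atom p)       n _ _ = ⟹-refl
    dpos-sound (¬ᶠ atom p)    n _ _ = ⟹-refl
    dpos-sound A@⊤ᶠ           n sf (h ∷ []) = pos-sound n A (suc n) sf h
    dpos-sound A@⊥ᶠ           n sf (h ∷ []) = pos-sound n A (suc n) sf h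
    dpos-sound startᶠ         n () _
    dpos-sound (¬ᶠ startᶠ)    n () _
    dpos-sound A@(¬ᶠ ⊤ᶠ)      n sf (h ∷ []) = pos-sound n A (suc n) sf h
    dpos-sound A@(¬ᶠ ⊥ᶠ)      n sf (h ∷ []) = pos-sound n A (suc n) sf h
    dpos-sound A@(¬ᶠ ¬ᶠ _)    n sf (h ∷ []) = pos-sound n A (suc n) sf h
    dpos-sound A@(¬ᶠ (_ ∨ᶠ _)) n sf (h ∷ []) = pos-sound n A (suc n) sf h
    dpos-sound A@(¬ᶠ (_ ∧ᶠ _)) n sf (h ∷ []) = pos-sound n A (suc n) sf h
    dpos-sound A@(¬ᶠ (_ ⇒ᶠ _)) n sf (h ∷ []) = pos-sound n A (suc n) sf h
    dpos-sound A@(¬ᶠ ○ _)     n sf (h ∷ []) = pos-sound n A (suc n) sf h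
    dpos-sound A@(¬ᶠ ◇ _)     n sf (h ∷ []) = pos-sound n A (suc n) sf h
    dpos-sound A@(¬ᶠ □ _)     n sf (h ∷ []) = pos-sound n A (suc n) sf h
    dpos-sound A@(¬ᶠ (_ 𝒰 _)) n sf (h ∷ []) = pos-sound n A (suc n) sf h
    dpos-sound A@(¬ᶠ (_ 𝒲 _)) n sf (h ∷ []) = pos-sound n A (suc n) sf h
    dpos-sound A@(_ ∧ᶠ _)     n sf (h ∷ []) = pos-sound n A (suc n) sf h
    dpos-sound A@(_ ⇒ᶠ _)     n sf (h ∷ []) = pos-sound n A (suc n) sf h
    dpos-sound A@(○ _)        n sf (h ∷ []) = pos-sound n A (suc n) sf h
    dpos-sound A@(◇ _)        n sf (h ∷ []) = pos-sound n A (suc n) sf h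
    dpos-sound A@(□ _)        n sf (h ∷ []) = pos-sound n A (suc n) sf h
    dpos-sound A@(_ 𝒰 _)      n sf (h ∷ []) = pos-sound n A (suc n) sf h
    dpos-sound A@(_ 𝒲 _)      n sf (h ∷ []) = pos-sound n A (suc n) sf h

    dneg-sound : ∀ A n → StartFree A → SoundRenaming (¬ᶠ A) (proj₁ (dneg A n))
    dneg-sound (atom p)   n _ _ = ⟹-refl
    dneg-sound A@⊤ᶠ       n sf (h ∷ []) = neg-sound n A (suc n) sf h
    dneg-sound A@⊥ᶠ       n sf (h ∷ []) = neg-sound n A (suc n) sf h
    dneg-sound startᶠ     n () _
    dneg-sound A@(¬ᶠ _)   n sf (h ∷ []) = neg-sound n A (suc n) sf h
    dneg-sound A@(_ ∨ᶠ _) n sf (h ∷ []) = neg-sound n A (suc n) sf h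
    dneg-sound A@(_ ∧ᶠ _) n sf (h ∷ []) = neg-sound n A (suc n) sf h
    dneg-sound A@(_ ⇒ᶠ _) n sf (h ∷ []) = neg-sound n A (suc n) sf h
    dneg-sound A@(○ _)    n sf (h ∷ []) = neg-sound n A (suc n) sf h
    dneg-sound A@(◇ _)    n sf (h ∷ []) = neg-sound n A (suc n) sf h
    dneg-sound A@(□ _)    n sf (h ∷ []) = neg-sound n A (suc n) sf h
    dneg-sound A@(_ 𝒰 _)  n sf (h ∷ []) = neg-sound n A (suc n) sf h
    dneg-sound A@(_ 𝒲 _)  n sf (h ∷ []) = neg-sound n A (suc n) sf h

    litOr-sound : ∀ A n → StartFree A → SoundRenaming A (proj₁ (litOr A n))
    litOr-sound A n sf h with isLit A
    ... | true  = ⟹-refl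
    ... | false = pos-sound n A (suc n) sf (head h)

lemma1 : ExcludedMiddle 0ℓ → (W : Fm) (x : ℕ) → StartFree W →
         Valid (τ₁ x W ⇒ᶠ □ (atom x ⇒ᶠ W))
lemma1 em W x sf σ h i _ = ⟹-elim (pos-sound x W _ sf h) i
  where open Soundness em σ
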